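{- Let $V_{2k}$ denote the Möbius ladder on $2k$ vertices. If $k\ge 4$ is odd, then the set of lengths of cycles in $V_{2k}$ is exactly the set of even integers from $4$ to $2k$. If $k\ge 4$ is even, then the set of lengths of cycles in $V_{2k}$ is exactly the set consisting of the even integers from $4$ to $2k$ together with all integers from $k+1$ to $2k$.
   Context: For $k\ge 3$, the Möbius ladder $V_{2k}$ is the graph obtained from a cycle $v_0,v_1,\dots,v_{2k-1},v_0$ of length $2k$ by adding the $k$ chords $v_iv_{i+k}$ for $0\le i\le k-1$. The cycle spectrum of a graph is the set of lengths of its cycles. -}

module Defs where

open import Data.Nat using (ℕ; zero; suc; _+_; _*_; _≤_)
open import Data.Nat.Divisibility using (_∣_)
open import Data.Fin using (Fin; toℕ)
open import Data.List using (List; []; _∷_; _++_; length)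
open import Data.List.Relation.Unary.Linked using (Linked)
open import Data.List.Relation.Unary.Unique.Propositional using (Unique)
open import Data.Product using (_×_; Σ)
open import Data.Sum using (_⊎_)
open import Data.Empty using (⊥)
open import Relation.Nullary using (¬_)
open import Relation.Binary.PropositionalEquality using (_≡_)

Even : ℕ → Set
Even n = 2 ∣ n

Odd : ℕ → Set
Odd n = ¬ (2 ∣ n)

Vertex : ℕ → Set
Vertex k = Fin (2 * k)

-- rim edge of the cycle v_0 v_1 … v_{2k-1} v_0, oriented from v_i to v_{i+1 mod 2k}
RimStep : (k : ℕ) → Vertex k → Vertex k → Set
RimStep k i j = (suc (toℕ i) ≡ toℕ j) ⊎ (suc (toℕ i) ≡ 2 * k × toℕ j ≡ 0)

Chord : (k : ℕ) → Vertex k → Vertex k → Set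
Chord k i j = (toℕ i + k ≡ toℕ j) ⊎ (toℕ j + k ≡ toℕ i)

Adj : (k : ℕ) → Vertex k → Vertex k → Set
Adj k i j = RimStep k i j ⊎ RimStep k j i ⊎ Chord k i j

ClosedWalk : (k : ℕ) → List (Vertex k) → Set
ClosedWalk k [] = ⊥
ClosedWalk k (x ∷ xs) = Linked (Adj k) (x ∷ xs ++ x ∷ [])

IsCycle : (k : ℕ) → List (Vertex k) → Set
IsCycle k vs = (3 ≤ length vs) × Unique vs × ClosedWalk k vs

InCycleSpectrum : (k : ℕ) → ℕ → Set
InCycleSpectrum k L = Σ (List (Vertex k)) (λ vs → IsCycle k vs × length vs ≡ L)

{-# OPTIONS --safe #-}

-- Lift a walk along the covering ℤ → ℤ/2k of the rim: a forward rim step adds 1, a backward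
-- one subtracts 1, and a chord adds k ≡ -k.  A closed walk with u forward steps, v backward
-- steps and w chords thus has u + wk ≡ v (mod 2k).  Modulo 2, its length u + v + w is even
-- whenever w(k + 1) is, in particular always when k is odd; and if w is odd then
-- u + k ≡ v (mod 2k), which forces u + v ≥ k, so the length exceeds k.
-- Conversely, the rectangle on the rungs 0 and m - 1 is a cycle of length 2m, and a snake
-- crossing the rungs 0, …, d - 1 alternately downwards and upwards, then returning along the
-- bottom rail and the twisted edge from k - 1 to k, is a cycle of length k + d for odd d ≤ k.

module Submission where

open import Defs
open import Level using (0ℓ)
open import Function.Base using (_∘_; id)
open import Function.Bundles using (_⇔_; mk⇔)
open import Data.Nat.Base using (ℕ; zero; suc; _+_; _*_; _%_; _≤_; _<_; z≤n; s≤s)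
open import Data.Nat.Properties
open import Data.Nat.DivMod using ([m+kn]%n≡m%n; m<n⇒m%n≡m)
open import Data.Nat.Divisibility
  using (_∣?_; divides; ∣m∣n⇒∣m+n; ∣m+n∣m⇒∣n; ∣m⇒∣m*n; ∣n⇒∣m*n; m∣m*n; n∣m*n)
open import Data.Nat.Tactic.RingSolver using (solve)
open import Data.Fin.Base using (Fin; zero; suc; toℕ; fromℕ<)
open import Data.Fin.Properties using (toℕ-fromℕ<; injective⇒≤)
open import Data.List.Base
  using (List; []; _∷_; _++_; length; map; lookup; applyUpTo; upTo; applyDownFrom)
open import Data.List.Properties
  using (length-++; length-map; map-++; length-applyUpTo; length-applyDownFrom)
open import Data.List.Membership.Propositional.Properties
  using (∈-lookup; ∈-upTo⁻; ∈-applyDownFrom⁻)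
open import Data.List.Relation.Binary.Disjoint.Propositional using (Disjoint)
open import Data.List.Relation.Unary.All as All using (All)
import Data.List.Relation.Unary.All.Properties as Allₚ
import Data.List.Relation.Unary.AllPairs as AllPairs
open import Data.List.Relation.Unary.Linked as Linked using (Linked)
import Data.List.Relation.Unary.Linked.Properties as Linkedₚ
open import Data.List.Relation.Unary.Unique.Propositional using (Unique)
import Data.List.Relation.Unary.Unique.Propositional.Properties as Uniqueₚ
open import Data.Product.Base using (_×_; _,_; proj₂; ∃)
open import Data.Sum.Base using (_⊎_; inj₁; inj₂)
open import Relation.Binary.Bundles using (Setoid)
import Relation.Binary.Reasoning.Setoid as SetoidReasoning
open import Relation.Binary.PropositionalEquality
open import Relation.Nullary using (yes; no; contradiction)

private variable
  a b c d e k m n p u v L : ℕ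
  xs ys : List ℕ

-- Congruence modulo n

infix 4 _≡_[mod_]

data _≡_[mod_] (a b n : ℕ) : Set where
  congruent : ∀ p q → a + p * n ≡ b + q * n → a ≡ b [mod n ]

mod-reflexive : a ≡ b → a ≡ b [mod n ]
mod-reflexive a≡b = congruent 0 0 (cong (_+ 0) a≡b)

mod-sym : a ≡ b [mod n ] → b ≡ a [mod n ]
mod-sym (congruent p q eq) = congruent q p (sym eq)

mod-trans : a ≡ b [mod n ] → b ≡ c [mod n ] → a ≡ c [mod n ]
mod-trans {a} {b} {n} {c} (congruent p q eq₁) (congruent r s eq₂) =
  congruent (p + r) (q + s) chain
  where
  chain : a + (p + r) * n ≡ c + (q + s) * n
  chain = begin
    a + (p + r) * n    ≡⟨ solve (a ∷ p ∷ r ∷ n ∷ []) ⟩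
    a + p * n + r * n  ≡⟨ cong (_+ r * n) eq₁ ⟩
    b + q * n + r * n  ≡⟨ solve (b ∷ q ∷ r ∷ n ∷ []) ⟩
    b + r * n + q * n  ≡⟨ cong (_+ q * n) eq₂ ⟩
    c + s * n + q * n  ≡⟨ solve (c ∷ s ∷ q ∷ n ∷ []) ⟩
    c + (q + s) * n    ∎
    where open ≡-Reasoning

mod-setoid : ℕ → Setoid 0ℓ 0ℓ
mod-setoid n = record
  { Carrier       = ℕ
  ; _≈_           = λ a b → a ≡ b [mod n ]
  ; isEquivalence = record { refl = mod-reflexive refl ; sym = mod-sym ; trans = mod-trans }
  }

module ≡-mod-Reasoning (n : ℕ) = SetoidReasoning (mod-setoid n)

mod-+-congˡ : ∀ c → a ≡ b [mod n ] → c + a ≡ c + b [mod n ]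
mod-+-congˡ {a} {b} {n} c (congruent p q eq) = congruent p q chain
  where
  chain : c + a + p * n ≡ c + b + q * n
  chain = begin
    c + a + p * n    ≡⟨ +-assoc c a _ ⟩
    c + (a + p * n)  ≡⟨ cong (c +_) eq ⟩
    c + (b + q * n)  ≡⟨ +-assoc c b _ ⟨
    c + b + q * n    ∎
    where open ≡-Reasoning

mod-+-cancelʳ : ∀ c → a + c ≡ b + c [mod n ] → a ≡ b [mod n ]
mod-+-cancelʳ {a} {b} {n} c (congruent p q eq) = congruent p q (+-cancelʳ-≡ c _ _ chain)
  where
  chain : a + p * n + c ≡ b + q * n + c
  chain = begin
    a + p * n + c  ≡⟨ solve (a ∷ p ∷ n ∷ c ∷ []) ⟩
    a + c + p * n  ≡⟨ eq ⟩
    b + c + q * n  ≡⟨ solve (b ∷ c ∷ q ∷ n ∷ []) ⟩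
    b + q * n + c  ∎
    where open ≡-Reasoning

mod-+-* : ∀ a j → a + j * n ≡ a [mod n ]
mod-+-* a j = congruent 0 j (+-identityʳ _)

mod-canonical : a < n → b < n → a ≡ b [mod n ] → a ≡ b
mod-canonical {a} {n} {b} a<n@(s≤s _) b<n (congruent p q eq) = begin
  a                ≡⟨ m<n⇒m%n≡m a<n ⟨
  a % n            ≡⟨ [m+kn]%n≡m%n a p n ⟨
  (a + p * n) % n  ≡⟨ cong (_% n) eq ⟩
  (b + q * n) % n  ≡⟨ [m+kn]%n≡m%n b q n ⟩
  b % n            ≡⟨ m<n⇒m%n≡m b<n ⟩
  b                ∎
  where open ≡-Reasoning

mod-2*⇒even-+ : a ≡ b [mod 2 * n ] → Even (a + b)
mod-2*⇒even-+ {a} {b} {n} (congruent p q eq) =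
  ∣m+n∣m⇒∣n {m = p * (2 * n)} (divides (b + q * n) shifted) (∣n⇒∣m*n p (m∣m*n n))
  where
  shifted : p * (2 * n) + (a + b) ≡ (b + q * n) * 2
  shifted = begin
    p * (2 * n) + (a + b)  ≡⟨ solve (p ∷ n ∷ a ∷ b ∷ []) ⟩
    a + p * (2 * n) + b    ≡⟨ cong (_+ b) eq ⟩
    b + q * (2 * n) + b    ≡⟨ solve (b ∷ q ∷ n ∷ []) ⟩
    (b + q * n) * 2        ∎
    where open ≡-Reasoning

even-or-odd : ∀ n → Even n ⊎ ∃ λ j → n ≡ suc (j * 2)
even-or-odd zero = inj₁ (divides 0 refl)
even-or-odd (suc n) with even-or-odd n
... | inj₁ (divides j refl) = inj₂ (j , refl)
... | inj₂ (j , refl)       = inj₁ (divides (suc j) refl)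

odd⇒≡suc[j*2] : Odd n → ∃ λ j → n ≡ suc (j * 2)
odd⇒≡suc[j*2] {n} n-odd with even-or-odd n
... | inj₁ n-even = contradiction n-even n-odd
... | inj₂ half   = half

odd⇒even-suc : Odd n → Even (suc n)
odd⇒even-suc n-odd with j , refl ← odd⇒≡suc[j*2] n-odd = divides (suc j) refl

even∧3≤⇒4≤ : Even n → 3 ≤ n → 4 ≤ n
even∧3≤⇒4≤ n-even 3≤n with m≤n⇒m<n∨m≡n 3≤n
... | inj₁ 3<n  = 3<n
... | inj₂ refl = contradiction n-even (λ { (divides (suc (suc _)) ()) })

-- Lengths of closed walks

RimStepℕ : ℕ → ℕ → ℕ → Set
RimStepℕ k a b = (suc a ≡ b) ⊎ (suc a ≡ 2 * k × b ≡ 0)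

Chordℕ : ℕ → ℕ → ℕ → Set
Chordℕ k a b = (a + k ≡ b) ⊎ (b + k ≡ a)

-- Adj k i j is definitionally Adjℕ k (toℕ i) (toℕ j).
Adjℕ : ℕ → ℕ → ℕ → Set
Adjℕ k a b = RimStepℕ k a b ⊎ RimStepℕ k b a ⊎ Chordℕ k a b

rim-forward : suc a ≡ b → Adjℕ k a b
rim-forward = inj₁ ∘ inj₁

rim-backward : suc b ≡ a → Adjℕ k a b
rim-backward = inj₂ ∘ inj₁ ∘ inj₁

chord-up : a + k ≡ b → Adjℕ k a b
chord-up = inj₂ ∘ inj₂ ∘ inj₁

chord-down : b + k ≡ a → Adjℕ k a b
chord-down = inj₂ ∘ inj₂ ∘ inj₂

k+k≡2*k : ∀ k → k + k ≡ 2 * k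
k+k≡2*k k = cong (k +_) (sym (+-identityʳ k))

rung-top<2k : a < k → a + k < 2 * k
rung-top<2k {a} {k} a<k = subst (a + k <_) (k+k≡2*k k) (+-monoˡ-< k a<k)

-- Chords count as +k in either direction, since k ≡ -k (mod 2k).
record Displacement (k a b n : ℕ) : Set where
  constructor displacement
  field
    forward backward chords : ℕ
    steps : forward + backward + chords ≡ n
    lift  : forward + chords * k + a ≡ backward + b [mod 2 * k ]

open Displacement

edge-displacement : Adjℕ k a b → Displacement k a b 1
edge-displacement (inj₁ (inj₁ refl)) =
  displacement 1 0 0 refl (mod-reflexive refl)
edge-displacement (inj₁ (inj₂ (1+a≡2k , refl))) =
  displacement 1 0 0 refl (congruent 0 1 (cong (_+ 0) 1+a≡2k))
edge-displacement (inj₂ (inj₁ (inj₁ refl))) =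
  displacement 0 1 0 refl (mod-reflexive refl)
edge-displacement (inj₂ (inj₁ (inj₂ (1+b≡2k , refl)))) =
  displacement 0 1 0 refl (congruent 1 0 (cong (_+ 0) (sym 1+b≡2k)))
edge-displacement {k} {a} (inj₂ (inj₂ (inj₁ refl))) =
  displacement 0 0 1 refl (mod-reflexive (solve (k ∷ a ∷ [])))
edge-displacement {k} {b = b} (inj₂ (inj₂ (inj₂ refl))) =
  displacement 0 0 1 refl (congruent 0 1 (solve (k ∷ b ∷ [])))

displacement-trans : Displacement k a b m → Displacement k b c n → Displacement k a c (m + n)
displacement-trans {k} {a} {b} {c = c}
  (displacement u₁ v₁ w₁ refl lift₁) (displacement u₂ v₂ w₂ refl lift₂) =
  displacement (u₁ + u₂) (v₁ + v₂) (w₁ + w₂) (solve (u₁ ∷ u₂ ∷ v₁ ∷ v₂ ∷ w₁ ∷ w₂ ∷ [])) chain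
  where
  open ≡-mod-Reasoning (2 * k)
  chain : u₁ + u₂ + (w₁ + w₂) * k + a ≡ v₁ + v₂ + c [mod 2 * k ]
  chain = begin
    u₁ + u₂ + (w₁ + w₂) * k + a       ≡⟨ solve (u₁ ∷ u₂ ∷ w₁ ∷ w₂ ∷ k ∷ a ∷ []) ⟩
    (u₂ + w₂ * k) + (u₁ + w₁ * k + a) ≈⟨ mod-+-congˡ (u₂ + w₂ * k) lift₁ ⟩
    (u₂ + w₂ * k) + (v₁ + b)          ≡⟨ solve (u₂ ∷ w₂ ∷ k ∷ v₁ ∷ b ∷ []) ⟩
    v₁ + (u₂ + w₂ * k + b)            ≈⟨ mod-+-congˡ v₁ lift₂ ⟩
    v₁ + (v₂ + c)                     ≡⟨ +-assoc v₁ v₂ c ⟨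
    v₁ + v₂ + c                       ∎

walk-displacement : ∀ {a b : Vertex k} xs → Linked (Adj k) (a ∷ xs ++ b ∷ []) →
                    Displacement k (toℕ a) (toℕ b) (suc (length xs))
walk-displacement []       (a~b Linked.∷ Linked.[-]) = edge-displacement a~b
walk-displacement (x ∷ xs) (a~x Linked.∷ x⋯b)        =
  displacement-trans (edge-displacement a~x) (walk-displacement xs x⋯b)

closed-lift : (δ : Displacement k a a n) → forward δ + chords δ * k ≡ backward δ [mod 2 * k ]
closed-lift {a = a} δ = mod-+-cancelʳ a (lift δ)

closed-parity : (δ : Displacement k a a n) → Even (chords δ * suc k) → Even n
closed-parity {k} δ@(displacement u v w refl _) even-w[1+k] =
  ∣m+n∣m⇒∣n {m = w * k * 2} (subst Even regroup even-sum) (n∣m*n (w * k))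
  where
  even-sum : Even (u + w * k + v + w * suc k)
  even-sum = ∣m∣n⇒∣m+n (mod-2*⇒even-+ {n = k} (closed-lift δ)) even-w[1+k]
  regroup : u + w * k + v + w * suc k ≡ w * k * 2 + (u + v + w)
  regroup = solve (u ∷ w ∷ k ∷ v ∷ [])

half-turn : u + k ≡ v [mod 2 * k ] → k ≤ u + v
half-turn {u} {k} {v} u+k≡v = ≮⇒≥ λ u+v<k →
  let u<k = ≤-<-trans (m≤m+n u v) u+v<k
      v<k = ≤-<-trans (m≤n+m v u) u+v<k
      u+k≡v = mod-canonical (rung-top<2k u<k) (≤-trans v<k (m≤m+n k _)) u+k≡v
  in <⇒≱ v<k (subst (k ≤_) u+k≡v (m≤n+m k u))

closed-odd-chords : (δ : Displacement k a a n) → Odd (chords δ) → suc k ≤ n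
closed-odd-chords {k} δ@(displacement u v w refl _) w-odd with j , refl ← odd⇒≡suc[j*2] w-odd =
  subst (suc k ≤_) (sym (+-suc (u + v) (j * 2)))
    (s≤s (≤-trans (half-turn u+k≡v) (m≤m+n (u + v) (j * 2))))
  where
  open ≡-mod-Reasoning (2 * k)
  u+k≡v : u + k ≡ v [mod 2 * k ]
  u+k≡v = begin
    u + k                ≈⟨ mod-+-* (u + k) j ⟨
    u + k + j * (2 * k)  ≡⟨ solve (u ∷ k ∷ j ∷ []) ⟩
    u + suc (j * 2) * k  ≈⟨ closed-lift δ ⟩
    v                    ∎

closed-even-or-long : Displacement k a a n → Even n ⊎ suc k ≤ n
closed-even-or-long δ with 2 ∣? chords δ
... | yes w-even = inj₁ (closed-parity δ (∣m⇒∣m*n _ w-even))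
... | no  w-odd  = inj₂ (closed-odd-chords δ w-odd)

closed-even : Odd k → Displacement k a a n → Even n
closed-even k-odd δ = closed-parity δ (∣n⇒∣m*n (chords δ) (odd⇒even-suc k-odd))

lookup-injective : ∀ {A : Set} {xs : List A} → Unique xs →
                   ∀ {i j} → lookup xs i ≡ lookup xs j → i ≡ j
lookup-injective (_    AllPairs.∷ _) {zero}  {zero}  _     = refl
lookup-injective (x∉xs AllPairs.∷ _) {zero}  {suc j} x≡xⱼ =
  contradiction x≡xⱼ (All.lookup x∉xs (∈-lookup j))
lookup-injective (x∉xs AllPairs.∷ _) {suc i} {zero}  xᵢ≡x =
  contradiction (sym xᵢ≡x) (All.lookup x∉xs (∈-lookup i))
lookup-injective (_    AllPairs.∷ u) {suc i} {suc j} xᵢ≡xⱼ = cong suc (lookup-injective u xᵢ≡xⱼ)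

unique-length≤ : ∀ {xs : List (Fin n)} → Unique xs → length xs ≤ n
unique-length≤ u = injective⇒≤ (lookup-injective u)

spectrum-displacement : InCycleSpectrum k L → ∃ λ a → Displacement k a a L
spectrum-displacement ([]     , (_ , _ , ()) , _)
spectrum-displacement (x ∷ xs , (_ , _ , closed) , refl) = toℕ x , walk-displacement xs closed

spectrum-3≤ : InCycleSpectrum k L → 3 ≤ L
spectrum-3≤ (_ , (3≤L , _ , _) , refl) = 3≤L

spectrum-≤2k : InCycleSpectrum k L → L ≤ 2 * k
spectrum-≤2k (_ , (_ , unique , _) , refl) = unique-length≤ unique

spectrum-even : Odd k → InCycleSpectrum k L → Even L
spectrum-even k-odd σ = closed-even k-odd (proj₂ (spectrum-displacement σ))

spectrum-even-or-long : InCycleSpectrum k L → Even L ⊎ suc k ≤ L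
spectrum-even-or-long σ = closed-even-or-long (proj₂ (spectrum-displacement σ))

-- Cycles from paths of natural numbers

infixr 5 _◅_

data Path (k : ℕ) : ℕ → List ℕ → ℕ → Set where
  [_] : ∀ a → Path k a (a ∷ []) a
  _◅_ : Adjℕ k a b → Path k b xs c → Path k a (a ∷ xs) c

path-++ : Path k a xs b → Adjℕ k b c → Path k c ys d → Path k a (xs ++ ys) d
path-++ [ _ ]     b~c q = b~c ◅ q
path-++ (a~x ◅ p) b~c q = a~x ◅ path-++ p b~c q

path⇒linked : Path k a xs b → Linked (Adjℕ k) xs
path⇒linked [ _ ]             = Linked.[-]
path⇒linked (a~b ◅ [ _ ])     = a~b Linked.∷ Linked.[-]
path⇒linked (a~b ◅ p@(_ ◅ _)) = a~b Linked.∷ path⇒linked p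

path-source : Path k a (b ∷ xs) c → b ≡ a
path-source [ _ ]   = refl
path-source (_ ◅ _) = refl

path-applyUpTo : ∀ f → (∀ i → Adjℕ k (f i) (f (suc i))) →
                 ∀ n → Path k (f 0) (applyUpTo f (suc n)) (f n)
path-applyUpTo f step zero    = [ f 0 ]
path-applyUpTo f step (suc n) = step 0 ◅ path-applyUpTo (f ∘ suc) (step ∘ suc) n

path-applyDownFrom : ∀ f → (∀ i → Adjℕ k (f (suc i)) (f i)) →
                     ∀ n → Path k (f n) (applyDownFrom f (suc n)) (f 0)
path-applyDownFrom f step zero    = [ f 0 ]
path-applyDownFrom f step (suc n) = step n ◅ path-applyDownFrom f step n

toℕ-onto : All (_< n) xs → ∃ λ (fs : List (Fin n)) → map toℕ fs ≡ xs
toℕ-onto All.[]           = [] , refl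
toℕ-onto (x<n All.∷ xs<n) =
  let fs , eq = toℕ-onto xs<n in fromℕ< x<n ∷ fs , cong₂ _∷_ (toℕ-fromℕ< x<n) eq

closed-path-lift : ∀ (fs : List (Fin (2 * k))) → Path k a (map toℕ fs) b → Adjℕ k b a →
                   ClosedWalk k fs
closed-path-lift []       () _
closed-path-lift {k} (f ∷ fs) p b~a with refl ← path-source p =
  Linkedₚ.map⁻ {xs = f ∷ fs ++ f ∷ []}
    (subst (Linked (Adjℕ k)) (cong (toℕ f ∷_) (sym (map-++ toℕ fs (f ∷ []))))
      (path⇒linked (path-++ p b~a [ toℕ f ])))

cycle-from-path : Path k a xs b → Adjℕ k b a → Unique xs → All (_< 2 * k) xs →
                  length xs ≡ L → 3 ≤ L → InCycleSpectrum k L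
cycle-from-path p b~a unique bounded refl 3≤L with fs , refl ← toℕ-onto bounded =
  fs , (subst (3 ≤_) (length-map toℕ fs) 3≤L , Uniqueₚ.map⁻ unique , closed-path-lift fs p b~a) ,
  sym (length-map toℕ fs)

-- Even cycles: rectangles

rectangle : ℕ → ℕ → List ℕ
rectangle k m = upTo m ++ applyDownFrom (_+ k) m

rectangle-path : Path k 0 (rectangle k (suc d)) (0 + k)
rectangle-path {k} {d} =
  path-++ (path-applyUpTo id (λ _ → rim-forward refl) d) (chord-up refl)
          (path-applyDownFrom (_+ k) (λ _ → rim-backward refl) d)

rectangle-unique : m ≤ k → Unique (rectangle k m)
rectangle-unique {m} {k} m≤k =
  Uniqueₚ.++⁺ (Uniqueₚ.upTo⁺ m)
    (Uniqueₚ.applyDownFrom⁺₁ (_+ k) m (λ j<i _ → >⇒≢ (+-monoˡ-< k j<i))) disjoint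
  where
  disjoint : Disjoint (upTo m) (applyDownFrom (_+ k) m)
  disjoint (v∈bottom , v∈top) with i , _ , refl ← ∈-applyDownFrom⁻ (_+ k) v∈top =
    <⇒≱ (≤-trans (∈-upTo⁻ v∈bottom) m≤k) (m≤n+m k i)

rectangle-bounded : m ≤ k → All (_< 2 * k) (rectangle k m)
rectangle-bounded {m} {k} m≤k = Allₚ.++⁺
  (Allₚ.applyUpTo⁺₁ id m (λ i<m → <-≤-trans (<-≤-trans i<m m≤k) (m≤m+n k _)))
  (Allₚ.applyDownFrom⁺₁ (_+ k) m (λ i<m → rung-top<2k (<-≤-trans i<m m≤k)))

rectangle-length : ∀ k m → length (rectangle k m) ≡ m * 2
rectangle-length k m = begin
  length (upTo m ++ applyDownFrom (_+ k) m)          ≡⟨ length-++ (upTo m) ⟩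
  length (upTo m) + length (applyDownFrom (_+ k) m)  ≡⟨ cong₂ _+_ (length-applyUpTo id m)
                                                                  (length-applyDownFrom (_+ k) m) ⟩
  m + m                                              ≡⟨ solve (m ∷ []) ⟩
  m * 2                                              ∎
  where open ≡-Reasoning

rectangle-cycle : 2 ≤ m → m ≤ k → InCycleSpectrum k (m * 2)
rectangle-cycle {m} {k} 2≤m@(s≤s _) m≤k =
  cycle-from-path rectangle-path (chord-down refl) (rectangle-unique m≤k) (rectangle-bounded m≤k)
    (rectangle-length k m) (≤-trans (n≤1+n 3) (*-monoˡ-≤ 2 2≤m))

even-cycle : Even L → 4 ≤ L → L ≤ 2 * k → InCycleSpectrum k L
even-cycle {k = k} (divides m refl) 4≤L L≤2k =
  rectangle-cycle (*-cancelʳ-≤ 2 m 2 4≤L) (*-cancelʳ-≤ m k 2 (subst (m * 2 ≤_) (*-comm 2 k) L≤2k))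

-- Odd cycles: snakes

OnRungFrom : ℕ → ℕ → ℕ → Set
OnRungFrom k p x = (p ≤ x × x < k) ⊎ (p + k ≤ x × x < 2 * k)

onRungFrom-bottom : p ≤ a → a < k → OnRungFrom k p a
onRungFrom-bottom p≤a a<k = inj₁ (p≤a , a<k)

onRungFrom-top : p ≤ a → a < k → OnRungFrom k p (a + k)
onRungFrom-top {k = k} p≤a a<k = inj₂ (+-monoˡ-≤ k p≤a , rung-top<2k a<k)

onRungFrom-weaken : p ≤ a → OnRungFrom k a c → OnRungFrom k p c
onRungFrom-weaken p≤a (inj₁ (a≤c , c<k)) = inj₁ (≤-trans p≤a a≤c , c<k)
onRungFrom-weaken {k = k} p≤a (inj₂ (a+k≤c , c<2k)) =
  inj₂ (≤-trans (+-monoˡ-≤ k p≤a) a+k≤c , c<2k)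

onRungFrom-bounded : OnRungFrom k p a → a < 2 * k
onRungFrom-bounded {k} (inj₁ (_ , a<k)) = <-≤-trans a<k (m≤m+n k _)
onRungFrom-bounded (inj₂ (_ , a<2k))    = a<2k

bottom-before-≢ : a < p → OnRungFrom k p c → a ≢ c
bottom-before-≢ a<p (inj₁ (p≤c , _)) = <⇒≢ (<-≤-trans a<p p≤c)
bottom-before-≢ {p = p} {k} a<p (inj₂ (p+k≤c , _)) =
  <⇒≢ (<-≤-trans a<p (≤-trans (m≤m+n p k) p+k≤c))

top-before-≢ : k ≤ a → a < p + k → OnRungFrom k p c → a ≢ c
top-before-≢ k≤a _     (inj₁ (_ , c<k))   = >⇒≢ (<-≤-trans c<k k≤a)
top-before-≢ _   a<p+k (inj₂ (p+k≤c , _)) = <⇒≢ (<-≤-trans a<p+k p+k≤c)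

-- From the top of rung p, cross the rungs p, …, p + 2t alternately downwards and upwards,
-- then go e steps further along the bottom rail.
snake : ℕ → ℕ → ℕ → ℕ → List ℕ
snake k p zero    e = p + k ∷ applyUpTo (p +_) (suc e)
snake k p (suc t) e = p + k ∷ p ∷ suc p ∷ suc p + k ∷ snake k (2 + p) t e

snake-shift : ∀ p t e → p + (suc t * 2 + e) ≡ 2 + p + (t * 2 + e)
snake-shift p t e = solve (p ∷ t ∷ e ∷ [])

snake-path : ∀ p t e → Path k (p + k) (snake k p t e) (p + (t * 2 + e))
snake-path {k} p zero e =
  chord-down (cong (_+ k) (+-identityʳ p)) ◅
  path-applyUpTo (p +_) (λ i → rim-forward (sym (+-suc p i))) e
snake-path p (suc t) e =
  chord-down refl ◅ rim-forward refl ◅ chord-up refl ◅ rim-forward refl ◅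
  subst (Path _ _ _) (sym (snake-shift p t e)) (snake-path (2 + p) t e)

snake-length : ∀ k p t e → length (snake k p t e) ≡ t * 4 + suc (suc e)
snake-length k p zero    e = cong suc (length-applyUpTo (p +_) (suc e))
snake-length k p (suc t) e = cong (4 +_) (snake-length k (2 + p) t e)

rail-bounds : p + e < k → All (λ x → p ≤ x × x < k) (applyUpTo (p +_) (suc e))
rail-bounds {p} p+e<k = Allₚ.applyUpTo⁺₁ (p +_) _ λ i≤e →
  m≤m+n p _ , ≤-<-trans (+-monoʳ-≤ p (m<1+n⇒m≤n i≤e)) p+e<k

snake-fits : ∀ p t e → p + (suc t * 2 + e) < k → p < k × suc p < k × 2 + p + (t * 2 + e) < k
snake-fits {k} p t e fits = <-trans (n<1+n p) 1+p<k , 1+p<k , next-fits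
  where
  next-fits : 2 + p + (t * 2 + e) < k
  next-fits = subst (_< k) (snake-shift p t e) fits
  1+p<k : suc p < k
  1+p<k = ≤-trans (m≤m+n (2 + p) _) (<⇒≤ next-fits)

block-onRungs : suc p < k → All (OnRungFrom k (2 + p)) xs →
                All (OnRungFrom k (suc p)) (suc p ∷ suc p + k ∷ xs)
block-onRungs 1+p<k rest =
  onRungFrom-bottom ≤-refl 1+p<k All.∷ onRungFrom-top ≤-refl 1+p<k All.∷
  All.map (onRungFrom-weaken (n≤1+n _)) rest

snake-onRungs : ∀ p t e → p + (t * 2 + e) < k → All (OnRungFrom k p) (snake k p t e)
snake-onRungs p zero e fits =
  onRungFrom-top ≤-refl (≤-<-trans (m≤m+n p e) fits) All.∷
  All.map (λ (p≤x , x<k) → onRungFrom-bottom p≤x x<k) (rail-bounds fits)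
snake-onRungs p (suc t) e fits with p<k , 1+p<k , next-fits ← snake-fits p t e fits =
  onRungFrom-top ≤-refl p<k All.∷ onRungFrom-bottom ≤-refl p<k All.∷
  All.map (onRungFrom-weaken (n≤1+n p)) (block-onRungs 1+p<k (snake-onRungs (2 + p) t e next-fits))

snake-unique : ∀ p t e → p + (t * 2 + e) < k → Unique (snake k p t e)
snake-unique {k} p zero e fits =
  All.map (λ (_ , x<k) → >⇒≢ (<-≤-trans x<k (m≤n+m k p))) (rail-bounds fits) AllPairs.∷
  Uniqueₚ.applyUpTo⁺₁ (p +_) (suc e) (λ i<j _ → <⇒≢ (+-monoʳ-< p i<j))
snake-unique {k} p (suc t) e fits with p<k , 1+p<k , next-fits ← snake-fits p t e fits =
  (>⇒≢ (<-≤-trans p<k (m≤n+m k p)) All.∷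
    All.map (top-before-≢ (m≤n+m k p) (n<1+n (p + k))) block) AllPairs.∷
  All.map (bottom-before-≢ (n<1+n p)) block AllPairs.∷
  (<⇒≢ (<-≤-trans 1+p<k (m≤n+m k (suc p))) All.∷
    All.map (bottom-before-≢ (n<1+n (suc p))) rest) AllPairs.∷
  All.map (top-before-≢ (m≤n+m k (suc p)) (n<1+n (suc p + k))) rest AllPairs.∷
  snake-unique (2 + p) t e next-fits
  where
  rest : All (OnRungFrom k (2 + p)) (snake k (2 + p) t e)
  rest = snake-onRungs (2 + p) t e next-fits
  block : All (OnRungFrom k (suc p)) (suc p ∷ suc p + k ∷ snake k (2 + p) t e)
  block = block-onRungs 1+p<k rest

odd-cycle : 2 ≤ k → Odd d → d ≤ k → InCycleSpectrum k (k + d)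
odd-cycle 2≤k d-odd d≤k with t , refl ← odd⇒≡suc[j*2] d-odd with e , refl ← m≤n⇒∃[o]m+o≡n d≤k =
  cycle-from-path (snake-path 0 t e) (rim-forward refl) (snake-unique 0 t e ≤-refl)
    (All.map onRungFrom-bounded (snake-onRungs 0 t e ≤-refl)) length≡ (+-mono-≤ 2≤k (s≤s z≤n))
  where
  length≡ : length (snake (suc (t * 2) + e) 0 t e) ≡ suc (t * 2) + e + suc (t * 2)
  length≡ = trans (snake-length _ 0 t e) (solve (t ∷ e ∷ []))

long-cycle : Even k → 3 ≤ k → suc k ≤ L → L ≤ 2 * k → InCycleSpectrum k L
long-cycle {k} {L} k-even 3≤k k<L L≤2k with 2 ∣? L
... | yes L-even = even-cycle L-even (≤-trans (s≤s 3≤k) k<L) L≤2k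
... | no  L-odd with d , refl ← m≤n⇒∃[o]m+o≡n (<⇒≤ k<L) =
  odd-cycle (≤-trans (n≤1+n 2) 3≤k) (L-odd ∘ ∣m∣n⇒∣m+n k-even)
    (+-cancelˡ-≤ k d k (subst (k + d ≤_) (sym (k+k≡2*k k)) L≤2k))

theorem4 : (k : ℕ) → 4 ≤ k →
             (Odd k → (L : ℕ) →
                InCycleSpectrum k L ⇔ (Even L × 4 ≤ L × L ≤ 2 * k))
             × (Even k → (L : ℕ) →
                InCycleSpectrum k L ⇔ ((Even L × 4 ≤ L × L ≤ 2 * k) ⊎ (suc k ≤ L × L ≤ 2 * k)))
theorem4 k 4≤k = odd-k , even-k
  where
  even-range : InCycleSpectrum k L → Even L → Even L × 4 ≤ L × L ≤ 2 * k
  even-range σ L-even = L-even , even∧3≤⇒4≤ L-even (spectrum-3≤ σ) , spectrum-≤2k σ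

  odd-k : Odd k → ∀ L → InCycleSpectrum k L ⇔ (Even L × 4 ≤ L × L ≤ 2 * k)
  odd-k k-odd L = mk⇔ (λ σ → even-range σ (spectrum-even k-odd σ))
                      (λ (L-even , 4≤L , L≤2k) → even-cycle L-even 4≤L L≤2k)

  even-k : Even k → ∀ L →
           InCycleSpectrum k L ⇔ ((Even L × 4 ≤ L × L ≤ 2 * k) ⊎ (suc k ≤ L × L ≤ 2 * k))
  even-k k-even L = mk⇔ to from
    where
    to : InCycleSpectrum k L → (Even L × 4 ≤ L × L ≤ 2 * k) ⊎ (suc k ≤ L × L ≤ 2 * k)
    to σ with spectrum-even-or-long σ
    ... | inj₁ L-even = inj₁ (even-range σ L-even)
    ... | inj₂ k<L    = inj₂ (k<L , spectrum-≤2k σ)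

    from : (Even L × 4 ≤ L × L ≤ 2 * k) ⊎ (suc k ≤ L × L ≤ 2 * k) → InCycleSpectrum k L
    from (inj₁ (L-even , 4≤L , L≤2k)) = even-cycle L-even 4≤L L≤2k
    from (inj₂ (k<L , L≤2k))          = long-cycle k-even (≤-trans (n≤1+n 3) 4≤k) k<L L≤2k
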